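{- Let $\langle D;<\rangle$ be a (strict) linear order. Then $\langle D;<\rangle$ satisfies the scheme $\mathtt{D\text{ - }Inf}$ if and only if it satisfies the scheme $\mathtt{DCI}$.
   Context: Formulas are first-order formulas in the language $\{<\}$; a scheme holds in a structure if every instance (with further free variables read universally, as parameters) is true in it. $\mathtt{D\text{ - }Inf}$ is the scheme $$\exists x\,\varphi(x)\wedge\exists y\,\forall x\,[\varphi(x)\rightarrow y\leqslant x]\longrightarrow\exists z\,\forall y\,\big(\forall x\,[\varphi(x)\rightarrow y\leqslant x]\leftrightarrow y\leqslant z\big),$$ and $\mathtt{DCI}$ is the scheme $$\exists x\,\forall y\!<\!x\,\varphi(y)\;\wedge\;\forall x\big[\forall y\!<\!x\,\varphi(y)\rightarrow\exists z\!>\!x\,\forall y\!<\!z\,\varphi(y)\big]\longrightarrow\forall x\,\varphi(x),$$ for arbitrary formulas $\varphi$. -}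

module Defs where

open import Level using (Level; _⊔_; Lift; lift)
open import Data.Nat using (ℕ; _≟_)
open import Data.Empty using (⊥)
open import Data.Product using (Σ; _×_; _,_)
open import Data.Sum using (_⊎_)
open import Relation.Nullary using (¬_; yes; no)
open import Relation.Binary.PropositionalEquality using (_≡_; _≢_)

record StrictLinearOrder (a ℓ : Level) : Set (Level.suc (a ⊔ ℓ)) where
  field
    Carrier  : Set a
    _<_      : Carrier → Carrier → Set ℓ
    irrefl   : ∀ {x} → ¬ (x < x)
    trans    : ∀ {x y z} → x < y → y < z → x < z
    connected : ∀ {x y} → x ≢ y → (x < y) ⊎ (y < x)

  _≤_ : Carrier → Carrier → Set (a ⊔ ℓ)
  x ≤ y = (Lift a (x < y)) ⊎ (Lift ℓ (x ≡ y))

Var : Set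
Var = ℕ

infixr 4 _⇒'_
infixr 5 _∨'_
infixr 6 _∧'_
data Formula : Set where
  _<'_ _≐_   : Var → Var → Formula
  ⊥'         : Formula
  ¬'_        : Formula → Formula
  _∧'_ _∨'_ _⇒'_ : Formula → Formula → Formula
  ∀' ∃'      : Var → Formula → Formula

module _ {a ℓ : Level} (O : StrictLinearOrder a ℓ) where
  open StrictLinearOrder O

  Env : Set a
  Env = Var → Carrier

  _[_↦_] : Env → Var → Carrier → Env
  (ρ [ v ↦ d ]) w with w ≟ v
  ... | yes _ = d
  ... | no  _ = ρ w

  -- Tarskian satisfaction (read classically: see ExcludedMiddle
  -- hypothesis in the theorem)
  Sat : Env → Formula → Set (a ⊔ ℓ)
  Sat ρ (x <' y)  = Lift a (ρ x < ρ y)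
  Sat ρ (x ≐ y)   = Lift ℓ (ρ x ≡ ρ y)
  Sat ρ ⊥'        = Lift (a ⊔ ℓ) ⊥
  Sat ρ (¬' φ)    = ¬ Sat ρ φ
  Sat ρ (φ ∧' ψ)  = Sat ρ φ × Sat ρ ψ
  Sat ρ (φ ∨' ψ)  = Sat ρ φ ⊎ Sat ρ ψ
  Sat ρ (φ ⇒' ψ)  = Sat ρ φ → Sat ρ ψ
  Sat ρ (∀' v φ)  = (d : Carrier) → Sat (ρ [ v ↦ d ]) φ
  Sat ρ (∃' v φ)  = Σ Carrier (λ d → Sat (ρ [ v ↦ d ]) φ)

  -- The instance of a scheme for the formula φ(x) (distinguished free
  -- variable x, other free variables as parameters given by ρ),
  -- written out via the Tarskian semantics.  P d means φ(d).

  D-Inf-instance : (Carrier → Set (a ⊔ ℓ)) → Set (a ⊔ ℓ)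
  D-Inf-instance P =
    (Σ Carrier P) × (Σ Carrier λ y → ∀ x → P x → y ≤ x) →
    Σ Carrier λ z → ∀ y →
      ((∀ x → P x → y ≤ x) → y ≤ z) × (y ≤ z → ∀ x → P x → y ≤ x)

  DCI-instance : (Carrier → Set (a ⊔ ℓ)) → Set (a ⊔ ℓ)
  DCI-instance P =
    (Σ Carrier λ x → ∀ y → y < x → P y) ×
    (∀ x → (∀ y → y < x → P y) → Σ Carrier λ z → x < z × (∀ y → y < z → P y)) →
    ∀ x → P x

  pred : Formula → Var → Env → Carrier → Set (a ⊔ ℓ)
  pred φ x ρ d = Sat (ρ [ x ↦ d ]) φ

  Satisfies-D-Inf : Set (a ⊔ ℓ)
  Satisfies-D-Inf = (φ : Formula) (x : Var) (ρ : Env) → D-Inf-instance (pred φ x ρ)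

  Satisfies-DCI : Set (a ⊔ ℓ)
  Satisfies-DCI = (φ : Formula) (x : Var) (ρ : Env) → DCI-instance (pred φ x ρ)

-- Both schemes are first reduced to statements about arbitrary predicates
-- P on the carrier.  Writing LowerBound P for the set of lower bounds of P:
--
--  * D-Inf for ¬P implies DCI for P: if P failed somewhere, the
--    counterexamples would be nonempty and bounded below, so they would
--    have an infimum z; everything below z satisfies P, the progress
--    hypothesis pushes this past z to some z' > z, and z' is then a lower
--    bound of the counterexamples above their infimum.
--  * DCI for LowerBound P implies D-Inf for P: if P had no infimum, the
--    set of lower bounds would be inductive in the sense of DCI, so it
--    would be everything, making any element of P its minimum.
--
-- The theorem follows because ¬φ is a formula, and LowerBound P is
-- defined by a formula as soon as a fresh variable is chosen; the latter
-- needs the coincidence lemma (satisfaction depends only on the variables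
-- of φ) and the fact that DCI is invariant under pointwise equivalence.
module Submission where

open import Defs
open import Level using (Level; _⊔_; lift)
open import Data.Product using (_×_; Σ; _,_; proj₁; proj₂)
open import Data.Sum using (_⊎_; inj₁; inj₂)
open import Data.Empty using (⊥-elim)
open import Data.Nat as ℕ using (ℕ; suc)
open import Data.Nat.Properties using (m≤n⇒m≤n⊔o; m≤n⇒m≤o⊔n; m≤n⊔m; ≤-refl; <⇒≢)
open import Relation.Nullary using (¬_; yes; no)
open import Relation.Binary.PropositionalEquality using (_≡_; refl; sym; subst₂; _≢_)
open import Axiom.ExcludedMiddle using (ExcludedMiddle)

maxVar : Formula → ℕ
maxVar (x <' y)  = x ℕ.⊔ y
maxVar (x ≐ y)   = x ℕ.⊔ y
maxVar ⊥'        = 0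
maxVar (¬' φ)    = maxVar φ
maxVar (φ ∧' ψ)  = maxVar φ ℕ.⊔ maxVar ψ
maxVar (φ ∨' ψ)  = maxVar φ ℕ.⊔ maxVar ψ
maxVar (φ ⇒' ψ)  = maxVar φ ℕ.⊔ maxVar ψ
maxVar (∀' v φ)  = v ℕ.⊔ maxVar φ
maxVar (∃' v φ)  = v ℕ.⊔ maxVar φ

fresh : Formula → Var → Var
fresh φ x = suc (maxVar φ ℕ.⊔ x)

fresh-≢-var : ∀ φ x {w} → w ℕ.≤ maxVar φ → w ≢ fresh φ x
fresh-≢-var φ x w≤ = <⇒≢ (ℕ.s≤s (m≤n⇒m≤n⊔o x w≤))

fresh-≢-x : ∀ φ x → x ≢ fresh φ x
fresh-≢-x φ x = <⇒≢ (ℕ.s≤s (m≤n⊔m (maxVar φ) x))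

module Assignments {a ℓ : Level} (O : StrictLinearOrder a ℓ) where
  open StrictLinearOrder O

  _⟨_≔_⟩ : Env O → Var → Carrier → Env O
  ρ ⟨ v ≔ d ⟩ = _[_↦_] O ρ v d

  update-same : ∀ ρ v d → (ρ ⟨ v ≔ d ⟩) v ≡ d
  update-same ρ v d with v ℕ.≟ v
  ... | yes _   = refl
  ... | no v≢v = ⊥-elim (v≢v refl)

  update-other : ∀ ρ v d {w} → w ≢ v → (ρ ⟨ v ≔ d ⟩) w ≡ ρ w
  update-other ρ v d {w} w≢v with w ℕ.≟ v
  ... | yes w≡v = ⊥-elim (w≢v w≡v)
  ... | no _    = refl

  Agree : ℕ → Env O → Env O → Set a
  Agree n ρ σ = ∀ w → w ℕ.≤ n → ρ w ≡ σ w

  agree-sym : ∀ {n ρ σ} → Agree n ρ σ → Agree n σ ρ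
  agree-sym h w w≤n = sym (h w w≤n)

  agree-left : ∀ {m n ρ σ} → Agree (m ℕ.⊔ n) ρ σ → Agree m ρ σ
  agree-left {n = n} h w w≤m = h w (m≤n⇒m≤n⊔o n w≤m)

  agree-right : ∀ {m n ρ σ} → Agree (m ℕ.⊔ n) ρ σ → Agree n ρ σ
  agree-right {m = m} h w w≤n = h w (m≤n⇒m≤o⊔n m w≤n)

  agree-update : ∀ {n ρ σ} u d → Agree (u ℕ.⊔ n) ρ σ → Agree n (ρ ⟨ u ≔ d ⟩) (σ ⟨ u ≔ d ⟩)
  agree-update u d h w w≤n with w ℕ.≟ u
  ... | yes _ = refl
  ... | no _  = agree-right {m = u} h w w≤n

  coincidence : ∀ φ {ρ σ} → Agree (maxVar φ) ρ σ → Sat O ρ φ → Sat O σ φ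
  coincidence (x <' y) h (lift s) =
    lift (subst₂ _<_ (agree-left {m = x} h x ≤-refl) (agree-right {m = x} h y ≤-refl) s)
  coincidence (x ≐ y) h (lift s) =
    lift (subst₂ _≡_ (agree-left {m = x} h x ≤-refl) (agree-right {m = x} h y ≤-refl) s)
  coincidence ⊥' h s = s
  coincidence (¬' φ) h s t = s (coincidence φ (agree-sym h) t)
  coincidence (φ ∧' ψ) h (s , t) =
    coincidence φ (agree-left {m = maxVar φ} h) s , coincidence ψ (agree-right {m = maxVar φ} h) t
  coincidence (φ ∨' ψ) h (inj₁ s) = inj₁ (coincidence φ (agree-left {m = maxVar φ} h) s)
  coincidence (φ ∨' ψ) h (inj₂ t) = inj₂ (coincidence ψ (agree-right {m = maxVar φ} h) t)
  coincidence (φ ⇒' ψ) h f s =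
    coincidence ψ (agree-right {m = maxVar φ} h)
      (f (coincidence φ (agree-sym (agree-left {m = maxVar φ} h)) s))
  coincidence (∀' u φ) h f d = coincidence φ (agree-update u d h) (f d)
  coincidence (∃' u φ) h (d , s) = d , coincidence φ (agree-update u d h) s

module Order {a ℓ : Level} (O : StrictLinearOrder a ℓ) where
  open StrictLinearOrder O

  Pred : Set (Level.suc (a ⊔ ℓ))
  Pred = Carrier → Set (a ⊔ ℓ)

  ≤-reflexive : ∀ {x} → x ≤ x
  ≤-reflexive = inj₂ (lift refl)

  <⇒≤ : ∀ {x y} → x < y → x ≤ y
  <⇒≤ x<y = inj₁ (lift x<y)

  <-≤-trans : ∀ {x y z} → x < y → y ≤ z → x < z
  <-≤-trans x<y (inj₁ (lift y<z)) = trans x<y y<z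
  <-≤-trans x<y (inj₂ (lift refl)) = x<y

  ≤-transitive : ∀ {x y z} → x ≤ y → y ≤ z → x ≤ z
  ≤-transitive (inj₁ (lift x<y)) y≤z = <⇒≤ (<-≤-trans x<y y≤z)
  ≤-transitive (inj₂ (lift refl)) y≤z = y≤z

  <-≤-asym : ∀ {x y} → x < y → ¬ (y ≤ x)
  <-≤-asym x<y y≤x = irrefl (<-≤-trans x<y y≤x)

  LowerBound : Pred → Pred
  LowerBound P y = ∀ x → P x → y ≤ x

  IsInf : Pred → Carrier → Set (a ⊔ ℓ)
  IsInf P z = ∀ y → (LowerBound P y → y ≤ z) × (y ≤ z → LowerBound P y)

  lowerBound-downward : ∀ (P : Pred) {x y} → LowerBound P x → y ≤ x → LowerBound P y
  lowerBound-downward P lb y≤x c Pc = ≤-transitive y≤x (lb c Pc)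

  minimum-isInf : ∀ (P : Pred) {z} → LowerBound P z → P z → IsInf P z
  minimum-isInf P lb Pz y = (λ lby → lby _ Pz) , λ y≤z → lowerBound-downward P lb y≤z

  dci-respects-⇔ : ∀ (P Q : Pred) → (∀ d → P d → Q d) → (∀ d → Q d → P d) →
                   DCI-instance O P → DCI-instance O Q
  dci-respects-⇔ P Q to from dci ((x₀ , below) , progress) x =
    to x (dci ((x₀ , λ y y<x₀ → from y (below y y<x₀)) , progress′) x)
    where
    progress′ : ∀ x → (∀ y → y < x → P y) → Σ Carrier λ z → x < z × (∀ y → y < z → P y)
    progress′ x h =
      let (z , x<z , belowz) = progress x (λ y y<x → to y (h y y<x))
      in z , x<z , λ y y<z → from y (belowz y y<z)

module Classical {a ℓ : Level} (lem : ExcludedMiddle (a ⊔ ℓ)) (O : StrictLinearOrder a ℓ) where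
  open StrictLinearOrder O
  open Order O

  -- Connectedness plus excluded middle on equality gives x ≤ y or y < x.
  ≤-or-> : ∀ x y → x ≤ y ⊎ y < x
  ≤-or-> x y with lem {Level.Lift ℓ (x ≡ y)}
  ... | yes (lift x≡y) = inj₁ (inj₂ (lift x≡y))
  ... | no x≢y with connected (λ x≡y → x≢y (lift x≡y))
  ...   | inj₁ x<y = inj₁ (<⇒≤ x<y)
  ...   | inj₂ y<x = inj₂ y<x

  none-below⇒lowerBound : ∀ (R : Pred) x → (∀ y → y < x → ¬ R y) → LowerBound R x
  none-below⇒lowerBound R x h c Rc with ≤-or-> x c
  ... | inj₁ x≤c = x≤c
  ... | inj₂ c<x = ⊥-elim (h c c<x Rc)

  lowerBound-¬⇒below : ∀ (P : Pred) x → LowerBound (λ c → ¬ P c) x → ∀ y → y < x → P y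
  lowerBound-¬⇒below P x lb y y<x with lem {P y}
  ... | yes Py = Py
  ... | no ¬Py = ⊥-elim (<-≤-asym y<x (lb y ¬Py))

  lowerBound-not-inf : ∀ (P : Pred) {z} → LowerBound P z → ¬ IsInf P z →
                       Σ Carrier λ y → LowerBound P y × z < y
  lowerBound-not-inf P {z} lb notInf with lem {Σ Carrier λ y → LowerBound P y × z < y}
  ... | yes above = above
  ... | no none = ⊥-elim (notInf isInf)
    where
    isInf : IsInf P z
    isInf y = below-z , lowerBound-downward P lb
      where
      below-z : LowerBound P y → y ≤ z
      below-z lby with ≤-or-> y z
      ... | inj₁ y≤z = y≤z
      ... | inj₂ z<y = ⊥-elim (none (y , lby , z<y))

  not-lowerBound⇒witness : ∀ (P : Pred) x → ¬ LowerBound P x → Σ Carrier λ w → P w × w < x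
  not-lowerBound⇒witness P x notLb with lem {Σ Carrier λ w → P w × w < x}
  ... | yes w = w
  ... | no none = ⊥-elim (notLb (none-below⇒lowerBound P x λ y y<x Py → none (y , Py , y<x)))

  dinf-¬⇒dci : ∀ (P : Pred) → D-Inf-instance O (λ c → ¬ P c) → DCI-instance O P
  dinf-¬⇒dci P dinf ((x₀ , belowx₀) , progress) t with lem {P t}
  ... | yes Pt = Pt
  ... | no ¬Pt = ⊥-elim (infimum-impossible (dinf ((t , ¬Pt) , (x₀ , lbOf¬P x₀ belowx₀))))
    where
    lbOf¬P : ∀ x → (∀ y → y < x → P y) → LowerBound (λ c → ¬ P c) x
    lbOf¬P x below = none-below⇒lowerBound (λ c → ¬ P c) x λ y y<x ¬Py → ¬Py (below y y<x)
    -- Progress at the infimum z yields a lower bound z′ > z.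
    infimum-impossible : ¬ Σ Carrier (IsInf (λ c → ¬ P c))
    infimum-impossible (z , isInf) =
      let (z′ , z<z′ , belowz′) = progress z (lowerBound-¬⇒below P z (proj₂ (isInf z) ≤-reflexive))
      in <-≤-asym z<z′ (proj₁ (isInf z′) (lbOf¬P z′ belowz′))

  dci-lowerBound⇒dinf : ∀ (P : Pred) → DCI-instance O (LowerBound P) → D-Inf-instance O P
  dci-lowerBound⇒dinf P dci ((e , Pe) , (b , lbb)) with lem {Σ Carrier (IsInf P)}
  ... | yes inf = inf
  ... | no noInf = ⊥-elim (noInf (e , minimum-isInf P (dci (start , progress) e) Pe))
    where
    start : Σ Carrier λ x → ∀ y → y < x → LowerBound P y
    start = b , λ y y<b → lowerBound-downward P lbb (<⇒≤ y<b)
    progress : ∀ x → (∀ y → y < x → LowerBound P y) →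
               Σ Carrier λ z → x < z × (∀ y → y < z → LowerBound P y)
    progress x below with lem {LowerBound P x}
    ... | yes lbx =
          let (y , lby , x<y) = lowerBound-not-inf P lbx (λ isInf → noInf (x , isInf))
          in y , x<y , λ y′ y′<y → lowerBound-downward P lby (<⇒≤ y′<y)
    ... | no notLbx =
          let (w , Pw , w<x) = not-lowerBound⇒witness P x notLbx
          in ⊥-elim (noInf (w , minimum-isInf P (below w w<x) Pw))

module LowerBoundFormula {a ℓ : Level} (O : StrictLinearOrder a ℓ) (φ : Formula) (x : Var) where
  open StrictLinearOrder O
  open Assignments O
  open Order O

  v : Var
  v = fresh φ x

  lowerBoundFormula : Formula
  lowerBoundFormula = ∀' x (φ ⇒' (v <' x ∨' v ≐ x))

  module _ (ρ : Env O) (d c : Carrier) where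
    σ : Env O
    σ = (ρ ⟨ v ≔ d ⟩) ⟨ x ≔ c ⟩

    -- σ differs from ρ ⟨ x ≔ c ⟩ only at v, which does not occur in φ.
    σ-agrees : Agree (maxVar φ) σ (ρ ⟨ x ≔ c ⟩)
    σ-agrees w w≤ with w ℕ.≟ x
    ... | yes _ = refl
    ... | no _  = update-other ρ v d (fresh-≢-var φ x w≤)

    σ-x : σ x ≡ c
    σ-x = update-same (ρ ⟨ v ≔ d ⟩) x c

    σ-v : σ v ≡ d
    σ-v with v ℕ.≟ x
    ... | yes v≡x = ⊥-elim (fresh-≢-x φ x (sym v≡x))
    ... | no _    = update-same ρ v d

  defines-lowerBound : ∀ ρ d → pred O lowerBoundFormula v ρ d → LowerBound (pred O φ x ρ) d
  defines-lowerBound ρ d h c φc =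
    subst₂ _≤_ (σ-v ρ d c) (σ-x ρ d c) (h c (coincidence φ (agree-sym (σ-agrees ρ d c)) φc))

  lowerBound-defined : ∀ ρ d → LowerBound (pred O φ x ρ) d → pred O lowerBoundFormula v ρ d
  lowerBound-defined ρ d lb c φc =
    subst₂ _≤_ (sym (σ-v ρ d c)) (sym (σ-x ρ d c)) (lb c (coincidence φ (σ-agrees ρ d c) φc))

  dci-lowerBound : Satisfies-DCI O → ∀ ρ → DCI-instance O (LowerBound (pred O φ x ρ))
  dci-lowerBound dci ρ =
    dci-respects-⇔ _ _ (defines-lowerBound ρ) (lowerBound-defined ρ) (dci lowerBoundFormula v ρ)

theorem3p6 : {a ℓ : Level} → ExcludedMiddle (a ⊔ ℓ) → (O : StrictLinearOrder a ℓ) →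
    (Satisfies-D-Inf O → Satisfies-DCI O) × (Satisfies-DCI O → Satisfies-D-Inf O)
-- D-Inf for ¬φ gives DCI for φ; DCI for lowerBoundFormula gives D-Inf for φ.
theorem3p6 lem O =
  (λ dinf φ x ρ → dinf-¬⇒dci (pred O φ x ρ) (dinf (¬' φ) x ρ)) ,
  (λ dci φ x ρ → dci-lowerBound⇒dinf (pred O φ x ρ) (LowerBoundFormula.dci-lowerBound O φ x dci ρ))
  where
  open Classical lem O
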